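{- Let $\lambda,\mu,\nu,\rho$ be partitions with $k$ parts (parts may be zero) such that $\mu\subseteq\lambda$ and $\rho\subseteq\nu$, and let $V(\lambda/\mu,\nu/\rho)$ be the set of cells lying in exactly one of $\min(\lambda/\mu,\nu/\rho)$ and $\lambda/\mu\wedge\nu/\rho$. Let $s\in V(\lambda/\mu,\nu/\rho)$. If $s\in\lambda/\mu$ then $s$ is incomparable to every cell of $\nu/\rho$; if $s\in\nu/\rho$ then $s$ is incomparable to every cell of $\lambda/\mu$.
   Context: Cells are pairs $(i,j)$ of positive integers (row $i$, column $j$), partially ordered by $(i,j)\ge(i',j')$ iff $i\ge i'$ and $j\ge j'$. For partitions $\beta\subseteq\alpha$, the skew shape $\alpha/\beta$ is the set of cells $\{(i,j):\beta_i<j\le\alpha_i\}$ (a convex subset of this poset). $\min(\lambda/\mu,\nu/\rho)$ is the skew shape $(\min(\lambda_1,\nu_1),\dots,\min(\lambda_k,\nu_k))/(\min(\mu_1,\rho_1),\dots,\min(\mu_k,\rho_k))$. For a convex set $Q$ of cells and a cell $s\notin Q$: $s<Q$ if $s<t$ for some $t\in Q$; $s>Q$ if $s>t$ for some $t\in Q$; $s\sim Q$ if $s\in Q$ or $s$ is incomparable to all cells of $Q$. For convex $Q,R$: $Q\wedge R=\{s\in R: s<Q\}\cup\{s\in Q: s\sim R\text{ or } s<R\}$. Here $\lambda/\mu\wedge\nu/\rho$ is computed with $Q=\lambda/\mu$, $R=\nu/\rho$ viewed as sets of cells. -}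

module Defs where

open import Data.Nat using (ℕ; suc; _≤_; _<_; _⊓_)
open import Data.Fin using (Fin; toℕ)
import Data.Fin as F
open import Data.Vec using (Vec; lookup; zipWith)
open import Data.Product using (_×_; Σ; ∃; _,_)
open import Data.Sum using (_⊎_)
open import Relation.Nullary using (¬_)
open import Relation.Binary.PropositionalEquality using (_≡_)

-- A cell (i , j): row i, column j (positive integers; positivity is
-- enforced by membership in skew shapes below).
Cell : Set
Cell = ℕ × ℕ

_≤c_ : Cell → Cell → Set
(i , j) ≤c (i' , j') = (i ≤ i') × (j ≤ j')

_<c_ : Cell → Cell → Set
s <c t = (s ≤c t) × ¬ (s ≡ t)

Incomparable : Cell → Cell → Set
Incomparable s t = ¬ (s ≤c t) × ¬ (t ≤c s)

CellSet : Set₁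
CellSet = Cell → Set

IsPartition : ∀ {k} → Vec ℕ k → Set
IsPartition {k} v = ∀ (a b : Fin k) → a F.≤ b → lookup v b ≤ lookup v a

_⊆ₚ_ : ∀ {k} → Vec ℕ k → Vec ℕ k → Set
_⊆ₚ_ {k} β α = ∀ (a : Fin k) → lookup β a ≤ lookup α a

Skew : ∀ {k} → Vec ℕ k → Vec ℕ k → CellSet
Skew {k} α β (i , j) =
  Σ (Fin k) λ r → (suc (toℕ r) ≡ i) × (lookup β r < j) × (j ≤ lookup α r)

minSkew : ∀ {k} → Vec ℕ k → Vec ℕ k → Vec ℕ k → Vec ℕ k → CellSet
minSkew l m n r = Skew (zipWith _⊓_ l n) (zipWith _⊓_ m r)

_<Q_ : Cell → CellSet → Set
s <Q Q = ¬ Q s × ∃ λ t → Q t × (s <c t)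

_∼Q_ : Cell → CellSet → Set
s ∼Q Q = Q s ⊎ (∀ t → Q t → Incomparable s t)

_∧Q_ : CellSet → CellSet → CellSet
(Q ∧Q R) s = (R s × (s <Q Q)) ⊎ (Q s × ((s ∼Q R) ⊎ (s <Q R)))

V : ∀ {k} → Vec ℕ k → Vec ℕ k → Vec ℕ k → Vec ℕ k → CellSet
V l m n r s =
  (minSkew l m n r s × ¬ ((Skew l m ∧Q Skew n r) s))
  ⊎ (¬ minSkew l m n r s × (Skew l m ∧Q Skew n r) s)

{-# OPTIONS --safe #-}
-- Write s = (a + 1 , j), Q = λ/μ and R = ν/ρ, and let s ∈ Q. If s ∈ min(Q, R)
-- but s ∉ Q ∧ R, then s ∉ R (cells of Q ∩ R lie in Q ∧ R) although j ≤ ν_a,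
-- so j ≤ ρ_a and, ρ being a partition, no cell of R is ≤ s; no cell of R is
-- ≥ s either, as then s < R would put s into Q ∧ R. If s ∈ Q ∧ R but
-- s ∉ min(Q, R), then ν_a < j, so no cell of R is ≥ s, and incomparability
-- to R is the only way left for s to enter Q ∧ R. For s ∈ R the first case
-- is symmetric and the second cannot occur: every cell of Q ∧ R is ≤ some
-- cell of Q, whereas λ_a < j.
module Submission where

open import Defs
open import Data.Nat using (ℕ; suc; s≤s; _≤_; _<_; _⊓_; _<?_; _≤?_)
open import Data.Nat.Properties
  using (≤-refl; ≤-trans; <⇒≱; ≮⇒≥; ≰⇒>; suc-injective;
         m<n⇒m⊓o<n; m<n⇒o⊓m<n; ⊓-glb; m≤n⊓o⇒m≤n; m≤n⊓o⇒m≤o)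
open import Data.Fin using (Fin; toℕ)
open import Data.Fin.Properties using (toℕ-injective)
open import Data.Vec using (Vec; lookup)
open import Data.Vec.Properties using (lookup-zipWith)
open import Data.Product using (_×_; ∃; _,_)
open import Data.Sum using (_⊎_; inj₁; inj₂)
open import Data.Empty using (⊥-elim)
open import Relation.Nullary using (¬_; yes; no)
open import Relation.Binary.PropositionalEquality using (refl; subst; sym)

≤c-refl : ∀ (s : Cell) → s ≤c s
≤c-refl (i , j) = ≤-refl , ≤-refl

_≤some_ : Cell → CellSet → Set
s ≤some R = ∃ λ t → R t × s ≤c t

_≥some_ : Cell → CellSet → Set
s ≥some R = ∃ λ t → R t × t ≤c s

≤some⇒<Q : ∀ {Q s} → ¬ Q s → s ≤some Q → s <Q Q
≤some⇒<Q s∉Q (t , t∈Q , s≤t) = s∉Q , t , t∈Q , s≤t , λ { refl → s∉Q t∈Q }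

module _ {Q R : CellSet} {s : Cell} where

  ∈both⇒∧Q : Q s → R s → (Q ∧Q R) s
  ∈both⇒∧Q s∈Q s∈R = inj₂ (s∈Q , inj₁ (inj₁ s∈R))

  ∧Q⇒≤someˡ : (Q ∧Q R) s → s ≤some Q
  ∧Q⇒≤someˡ (inj₁ (_ , _ , t , t∈Q , s≤t , _)) = t , t∈Q , s≤t
  ∧Q⇒≤someˡ (inj₂ (s∈Q , _))                   = s , s∈Q , ≤c-refl s

  incomparable-∉∧Qˡ : Q s → ¬ (Q ∧Q R) s → ¬ s ≥some R →
                      ∀ t → R t → Incomparable s t
  incomparable-∉∧Qˡ s∈Q s∉∧ s≱R t t∈R =
    (λ s≤t → s∉∧ (inj₂ (s∈Q , inj₂ (≤some⇒<Q s∉R (t , t∈R , s≤t)))))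
    , λ t≤s → s≱R (t , t∈R , t≤s)
    where
    s∉R : ¬ R s
    s∉R s∈R = s∉∧ (∈both⇒∧Q s∈Q s∈R)

  incomparable-∉∧Qʳ : R s → ¬ (Q ∧Q R) s → ¬ s ≥some Q →
                      ∀ t → Q t → Incomparable s t
  incomparable-∉∧Qʳ s∈R s∉∧ s≱Q t t∈Q =
    (λ s≤t → s∉∧ (inj₁ (s∈R , ≤some⇒<Q s∉Q (t , t∈Q , s≤t))))
    , λ t≤s → s≱Q (t , t∈Q , t≤s)
    where
    s∉Q : ¬ Q s
    s∉Q s∈Q = s∉∧ (∈both⇒∧Q s∈Q s∈R)

  incomparable-∈∧Q : (Q ∧Q R) s → ¬ s ≤some R → ∀ t → R t → Incomparable s t
  incomparable-∈∧Q (inj₁ (s∈R , _))             s≰R = ⊥-elim (s≰R (s , s∈R , ≤c-refl s))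
  incomparable-∈∧Q (inj₂ (_ , inj₁ (inj₁ s∈R))) s≰R = ⊥-elim (s≰R (s , s∈R , ≤c-refl s))
  incomparable-∈∧Q (inj₂ (_ , inj₁ (inj₂ s⊥R))) _   = s⊥R
  incomparable-∈∧Q (inj₂ (_ , inj₂ (_ , t , t∈R , s≤t , _))) s≰R =
    ⊥-elim (s≰R (t , t∈R , s≤t))

row : ∀ {k} → Fin k → ℕ
row a = suc (toℕ a)

module _ {k} (α β : Vec ℕ k) where

  Skew-outer<⇒¬≤some : IsPartition α → ∀ a {j} → lookup α a < j →
                       ¬ (row a , j) ≤some Skew α β
  Skew-outer<⇒¬≤some pα a α<j (_ , (b , refl , _ , j′≤α) , s≤s a≤b , j≤j′) =
    <⇒≱ α<j (≤-trans j≤j′ (≤-trans j′≤α (pα a b a≤b)))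

  Skew-≤inner⇒¬≥some : IsPartition β → ∀ a {j} → j ≤ lookup β a →
                       ¬ (row a , j) ≥some Skew α β
  Skew-≤inner⇒¬≥some pβ a j≤β (_ , (b , refl , β<j′ , _) , s≤s b≤a , j′≤j) =
    <⇒≱ β<j′ (≤-trans j′≤j (≤-trans j≤β (pβ b a b≤a)))

  Skew-or-¬≥some : IsPartition β → ∀ a {j} → j ≤ lookup α a →
                   Skew α β (row a , j) ⊎ ¬ (row a , j) ≥some Skew α β
  Skew-or-¬≥some pβ a {j} j≤α with lookup β a <? j
  ... | yes β<j = inj₁ (a , refl , β<j , j≤α)
  ... | no β≮j  = inj₂ (Skew-≤inner⇒¬≥some pβ a (≮⇒≥ β≮j))

module _ {k} (l m n r : Vec ℕ k) (a : Fin k) {j : ℕ} where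

  minSkew-intro : lookup m a ⊓ lookup r a < j → j ≤ lookup l a ⊓ lookup n a →
                  minSkew l m n r (row a , j)
  minSkew-intro inner<j j≤outer =
    a , refl ,
    subst (_< j) (sym (lookup-zipWith _⊓_ a m r)) inner<j ,
    subst (j ≤_) (sym (lookup-zipWith _⊓_ a l n)) j≤outer

  minSkew-outer : minSkew l m n r (row a , j) → j ≤ lookup l a ⊓ lookup n a
  minSkew-outer (b , e , _ , j≤outer) with toℕ-injective (suc-injective e)
  ... | refl = subst (j ≤_) (lookup-zipWith _⊓_ a l n) j≤outer

  ∉minSkew⇒outer<ʳ : lookup m a < j → j ≤ lookup l a →
                     ¬ minSkew l m n r (row a , j) → lookup n a < j
  ∉minSkew⇒outer<ʳ μ<j j≤λ s∉M with j ≤? lookup n a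
  ... | yes j≤ν = ⊥-elim (s∉M (minSkew-intro (m<n⇒m⊓o<n _ μ<j) (⊓-glb j≤λ j≤ν)))
  ... | no j≰ν  = ≰⇒> j≰ν

  ∉minSkew⇒outer<ˡ : lookup r a < j → j ≤ lookup n a →
                     ¬ minSkew l m n r (row a , j) → lookup l a < j
  ∉minSkew⇒outer<ˡ ρ<j j≤ν s∉M with j ≤? lookup l a
  ... | yes j≤λ = ⊥-elim (s∉M (minSkew-intro (m<n⇒o⊓m<n _ ρ<j) (⊓-glb j≤λ j≤ν)))
  ... | no j≰λ  = ≰⇒> j≰λ

mainTheorem9 : ∀ (k : ℕ) (l m n r : Vec ℕ k) →
    IsPartition l → IsPartition m → IsPartition n → IsPartition r →
    m ⊆ₚ l → r ⊆ₚ n →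
    ∀ (s : Cell) → V l m n r s →
    ((Skew l m s → ∀ t → Skew n r t → Incomparable s t)
     × (Skew n r s → ∀ t → Skew l m t → Incomparable s t))
mainTheorem9 _ l m n r pl pm pn pr _ _ s v = left s v , right s v
  where
  left : ∀ s → V l m n r s → Skew l m s → ∀ t → Skew n r t → Incomparable s t
  left (_ , _) (inj₁ (s∈M , s∉∧)) s∈Q@(a , refl , _)
    with Skew-or-¬≥some n r pr a (m≤n⊓o⇒m≤o _ _ (minSkew-outer l m n r a s∈M))
  ... | inj₁ s∈R = ⊥-elim (s∉∧ (∈both⇒∧Q s∈Q s∈R))
  ... | inj₂ s≱R = incomparable-∉∧Qˡ s∈Q s∉∧ s≱R
  left (_ , _) (inj₂ (s∉M , s∈∧)) (a , refl , μ<j , j≤λ) =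
    incomparable-∈∧Q s∈∧
      (Skew-outer<⇒¬≤some n r pn a (∉minSkew⇒outer<ʳ l m n r a μ<j j≤λ s∉M))

  right : ∀ s → V l m n r s → Skew n r s → ∀ t → Skew l m t → Incomparable s t
  right (_ , _) (inj₁ (s∈M , s∉∧)) s∈R@(a , refl , _)
    with Skew-or-¬≥some l m pm a (m≤n⊓o⇒m≤n _ _ (minSkew-outer l m n r a s∈M))
  ... | inj₁ s∈Q = ⊥-elim (s∉∧ (∈both⇒∧Q s∈Q s∈R))
  ... | inj₂ s≱Q = incomparable-∉∧Qʳ s∈R s∉∧ s≱Q
  right (_ , _) (inj₂ (s∉M , s∈∧)) (a , refl , ρ<j , j≤ν) =
    ⊥-elim (Skew-outer<⇒¬≤some l m pl a (∉minSkew⇒outer<ˡ l m n r a ρ<j j≤ν s∉M)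
                               (∧Q⇒≤someˡ s∈∧))
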